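{- Let $\mathcal{F}$ be a spreading linear triple system on a vertex set $V$ with $|V|=n>5$. Let $G$ be its shadow and $\overline{G}$ the complement of $G$ on $V$. For a triple $T\in\mathcal{F}$ let $\mathrm{Val}(T)$ be the number of vertices outside $T$ adjacent in $G$ to exactly one vertex of $T$. Let $\mathcal{G}$ be the graph whose vertices are the triples of $\mathcal{F}$, where $T$ and $T'$ are adjacent if there is a pair of vertices in $T$ and a pair of vertices in $T'$ whose four vertices span a 4-cycle in $\overline{G}$. Let $A$ be the set of triples $T$ with $\mathrm{Val}(T)\geq\frac n2$ and $B$ the set of triples with $\mathrm{Val}(T)<\frac n2$, and let $\mathcal{G}[A,B]$ be the bipartite subgraph of $\mathcal{G}$ consisting of the edges between $A$ and $B$, with degree function $\deg$. Then $$\deg(T)\geq 3\binom{\frac13\mathrm{Val}(T)}{2}\quad\text{if } T\in A,$$ and $$\deg(T')\leq\binom{n-\mathrm{Val}(T)-1}{2}\quad\text{if } T'\in B \text{ and } T\sim T'.$$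
   Context: A linear triple system $\mathcal{F}$ on $V$ is a family of 3-element subsets (triples) of $V$ any two of which share at most one element. Its shadow $G=G(\mathcal{F})$ is the graph on $V$ whose edges are the pairs $xy$ contained in some triple of $\mathcal{F}$. For $V'\subseteq V$, $N(V')$ is the set of all $z\in V\setminus V'$ for which there exist distinct $x,y\in V'$ with $\{x,y,z\}\in\mathcal{F}$; the closure $\mathrm{cl}(V')$ is the smallest $W\supseteq V'$ with $N(W)=\emptyset$. A subset $V'$ is nontrivial if $|V'|\geq3$ and $V'\notin\mathcal{F}$. $\mathcal{F}$ is spreading if $\mathrm{cl}(V')=V$ for every nontrivial $V'\subseteq V$. For real $x$, $\binom{x}{2}=\frac{x(x-1)}{2}$. -}

module Defs where

open import Data.Bool using (Bool; true; false; not; _∧_; _∨_)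
open import Data.Nat using (ℕ; _*_; _≤_; _<_; _≤ᵇ_; _≡ᵇ_)
open import Data.Fin using (Fin; _≟_)
open import Data.Fin.Subset using (Subset; _∈_; _∉_; ⁅_⁆; _∪_; _∩_; _⊆_; ∣_∣; ⊤)
open import Data.List using (List; length; filterᵇ; allFin)
open import Data.Bool.ListAction using (any)
import Data.List.Membership.Propositional as LM
open import Data.List.Relation.Unary.All using (All)
open import Data.List.Relation.Unary.Unique.Propositional using (Unique)
open import Data.Vec using (lookup)
open import Data.Product using (_×_)
open import Relation.Nullary using (¬_; ⌊_⌋)
open import Relation.Binary.PropositionalEquality using (_≡_; _≢_)

-- Vertex set V = Fin n.  A triple system is a finite list of subsets of Fin n
-- (no repetitions, each of size 3).

module _ {n : ℕ} (F : List (Subset n)) where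

  IsTripleSystem : Set
  IsTripleSystem = All (λ T → ∣ T ∣ ≡ 3) F × Unique F

  IsLinear : Set
  IsLinear = ∀ T T' → T LM.∈ F → T' LM.∈ F → T ≢ T' → ∣ T ∩ T' ∣ ≤ 1

  triple : Fin n → Fin n → Fin n → Subset n
  triple x y z = ⁅ x ⁆ ∪ (⁅ y ⁆ ∪ ⁅ z ⁆)

  NEmpty : Subset n → Set
  NEmpty W = ∀ x y z → x ∈ W → y ∈ W → x ≢ y → z ∉ W → ¬ (triple x y z LM.∈ F)

  IsClosure : Subset n → Subset n → Set
  IsClosure V' W = V' ⊆ W × NEmpty W × (∀ W' → V' ⊆ W' → NEmpty W' → W ⊆ W')

  Nontrivial : Subset n → Set
  Nontrivial V' = 3 ≤ ∣ V' ∣ × ¬ (V' LM.∈ F)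

  IsSpreading : Set
  IsSpreading = ∀ V' → Nontrivial V' → ∀ W → IsClosure V' W → W ≡ ⊤

  _∈ᵇ_ : Fin n → Subset n → Bool
  x ∈ᵇ T = lookup T x

  _≠ᵇ_ : Fin n → Fin n → Bool
  x ≠ᵇ y = not ⌊ x ≟ y ⌋

  shadowEdge : Fin n → Fin n → Bool
  shadowEdge x y = (x ≠ᵇ y) ∧ any (λ T → (x ∈ᵇ T) ∧ (y ∈ᵇ T)) F

  coEdge : Fin n → Fin n → Bool
  coEdge x y = (x ≠ᵇ y) ∧ not (shadowEdge x y)

  countV : (Fin n → Bool) → ℕ
  countV p = length (filterᵇ p (allFin n))

  Val : Subset n → ℕ
  Val T = countV (λ v → not (v ∈ᵇ T) ∧ (countV (λ u → (u ∈ᵇ T) ∧ shadowEdge u v) ≡ᵇ 1))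

  cycleCo : Fin n → Fin n → Fin n → Fin n → Bool
  cycleCo p q r s = coEdge p q ∧ (coEdge q r ∧ (coEdge r s ∧ coEdge s p))

  -- four distinct vertices a b c d span a 4-cycle in the complement
  -- (one of the three possible 4-cycles on four labelled vertices)
  distinct4 : Fin n → Fin n → Fin n → Fin n → Bool
  distinct4 a b c d = (a ≠ᵇ b) ∧ ((a ≠ᵇ c) ∧ ((a ≠ᵇ d) ∧ ((b ≠ᵇ c) ∧ ((b ≠ᵇ d) ∧ (c ≠ᵇ d)))))

  spansC4co : Fin n → Fin n → Fin n → Fin n → Bool
  spansC4co a b c d = distinct4 a b c d ∧ (cycleCo a b c d ∨ (cycleCo a c b d ∨ cycleCo a b d c))

  anyV : (Fin n → Bool) → Bool
  anyV p = any p (allFin n)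

  adjᵇ : Subset n → Subset n → Bool
  adjᵇ T T' = anyV λ a → anyV λ b → anyV λ c → anyV λ d →
    (a ∈ᵇ T) ∧ ((b ∈ᵇ T) ∧ ((c ∈ᵇ T') ∧ ((d ∈ᵇ T') ∧ spansC4co a b c d)))

  Adj : Subset n → Subset n → Set
  Adj T T' = adjᵇ T T' ≡ true

  inAᵇ : Subset n → Bool
  inAᵇ T = n ≤ᵇ (2 * Val T)

  InA : Subset n → Set
  InA T = n ≤ 2 * Val T

  InB : Subset n → Set
  InB T = 2 * Val T < n

  crossAB : Subset n → Subset n → Bool
  crossAB T T' = (inAᵇ T ∧ not (inAᵇ T')) ∨ (not (inAᵇ T) ∧ inAᵇ T')

  deg : Subset n → ℕ
  deg T = length (filterᵇ (λ T' → crossAB T T' ∧ adjᵇ T T') F)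

-- In a spreading linear triple system on more than four vertices no closure has at most four
-- elements.  Hence the complement of the shadow G is triangle-free, and a vertex missing two
-- vertices of a triple is adjacent to the third.  Let X(S) be the set counted by Val(S).  If S ~ S′
-- via pairs {a, b} ⊆ S and {c, d} ⊆ S′, then c and d are adjacent to the third vertex e of S and
-- to nothing else in S, so {c, d} ⊆ X(S); X(S) and X(S′) are disjoint (a common vertex would
-- span a non-edge triangle with one vertex of each pair) and miss e, so Val(S) + Val(S′) < n.
-- The upper bound follows: every neighbour of S′ contains a pair of X(S′), and by linearity
-- distinct neighbours contain distinct pairs.  For the lower bound split X(S) into the classes
-- X_t of vertices whose neighbour in S is t.  Each class is a clique of G that meets every triple
-- in at most two vertices, and a triple meeting X_t in two vertices is adjacent to S and, as
-- Val(S) ≥ n/2, lies in B; no triple meets two classes in two vertices.  So deg(S) is at least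
-- the sum of the C(|X_t|, 2), which by convexity is at least 3 C(Val(S)/3, 2).

module Submission where

open import Defs
open import Data.Nat using (ℕ; _+_; _*_; _∸_; _≤_; _<_)
open import Data.Nat.Combinatorics using (_C_)
open import Data.Fin.Subset using (Subset)
open import Data.List using (List)
open import Data.List.Membership.Propositional using (_∈_)
open import Data.Product using (_×_)

open import Data.Bool using (Bool; true; false; T; not; _∧_; _∨_)
import Data.Bool as Bool
open import Data.Bool.Properties using (T-∧; T-∨; T-≡; T?)
open import Data.Bool.ListAction using (any)
open import Data.Fin using (Fin; _≟_)
import Data.Fin as Fin
open import Data.Fin.Subset using (∣_∣; ⁅_⁆; _∪_; _∩_; _⊆_) renaming (_∈_ to _∈ₛ_; _∉_ to _∉ₛ_)
open import Data.Fin.Subset.Properties using (x∈p∪q⁺; x∈p∪q⁻; x∈p∩q⁺; x∈⁅x⁆; x∈⁅y⁆⇒x≡y; ⊆-antisym; p⊆p∪q; q⊆p∪q; ∣⊤∣≡n) renaming (_∈?_ to _∈?ₛ_)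
open import Data.Vec using (lookup; []; _∷_)
open import Data.Vec.Properties using ([]=⇒lookup; lookup⇒[]=; ≡-dec)
open import Data.Nat using (zero; suc; z≤n; s≤s; _≡ᵇ_; _≤ᵇ_)
open import Data.Nat.Properties hiding (_≟_)
open import Data.Nat.Combinatorics using (nCk+nC[k+1]≡[n+1]C[k+1]; nC1≡n)
open import Data.Nat.Tactic.RingSolver using (solve-∀)
open import Data.List using ([]; _∷_; length; map; _++_; filterᵇ; allFin; tabulate)
open import Data.List.Properties using (length-++; length-map; length-removeAt′; length-tabulate)
open import Data.List.Relation.Unary.Any.Properties using (any⁺; any⁻)
open import Data.List.Relation.Unary.All.Properties using (¬Any⇒All¬)
open import Data.List.Membership.Propositional using (_∉_; find; lose)
open import Data.List.Membership.Propositional.Properties using (∈-++⁻; ∈-++⁺ˡ; ∈-++⁺ʳ; ∈-map⁻; ∈-map⁺; ∈-filter⁺; ∈-filter⁻; ∈-allFin)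
open import Data.List.Relation.Unary.Any using (here; there; index; _─_; any?)
open import Data.List.Relation.Unary.All using ([]; _∷_)
import Data.List.Relation.Unary.All as All
open import Data.List.Relation.Unary.AllPairs using ([]; _∷_)
open import Data.List.Relation.Unary.Unique.Propositional using (Unique)
import Data.List.Relation.Unary.Unique.Propositional.Properties as Unique
open import Data.List.Relation.Unary.Unique.Propositional.Properties using (allFin⁺)
open import Data.Product using (_,_; proj₁; proj₂; ∃-syntax)
open import Data.Sum using (_⊎_; inj₁; inj₂; [_,_]′)
open import Data.Empty using (⊥; ⊥-elim)
open import Data.Unit using (tt)
open import Function using (_∘_; id; flip; case_of_; Equivalence)
open import Relation.Nullary using (¬_; yes; no; ¬?; contradiction)
open import Relation.Nullary.Decidable using (decidable-stable; fromWitnessFalse; toWitnessFalse)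
open import Relation.Binary.Definitions using (DecidableEquality)
open import Relation.Binary.PropositionalEquality

suc-C2 : ∀ k → suc k C 2 ≡ k + k C 2
suc-C2 k = trans (sym (nCk+nC[k+1]≡[n+1]C[k+1] k 1)) (cong (_+ k C 2) (nC1≡n k))

C2-mono : ∀ {m n} → m ≤ n → m C 2 ≤ n C 2
C2-mono {zero} _ = z≤n
C2-mono {suc m} {suc n} (s≤s m≤n) rewrite suc-C2 m | suc-C2 n = +-mono-≤ m≤n (C2-mono m≤n)

2*C2+k≡k*k : ∀ k → 2 * (k C 2) + k ≡ k * k
2*C2+k≡k*k zero = refl
2*C2+k≡k*k (suc k) = begin
  2 * (suc k C 2) + suc k      ≡⟨ cong (λ c → 2 * c + suc k) (suc-C2 k) ⟩
  2 * (k + k C 2) + suc k      ≡⟨ regroup k (k C 2) ⟩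
  (2 * (k C 2) + k) + (2 * k + 1) ≡⟨ cong (_+ (2 * k + 1)) (2*C2+k≡k*k k) ⟩
  k * k + (2 * k + 1)          ≡⟨ square-suc k ⟩
  suc k * suc k                ∎
  where
  open ≡-Reasoning
  regroup : ∀ k c → 2 * (k + c) + suc k ≡ (2 * c + k) + (2 * k + 1)
  regroup = solve-∀
  square-suc : ∀ k → k * k + (2 * k + 1) ≡ suc k * suc k
  square-suc = solve-∀

2ab≤a²+b² : ∀ a b → 2 * (a * b) ≤ a * a + b * b
2ab≤a²+b² zero b = z≤n
2ab≤a²+b² (suc a) zero rewrite *-zeroʳ a = z≤n
2ab≤a²+b² (suc a) (suc b) = begin
  2 * (suc a * suc b)                       ≡⟨ lhs a b ⟩
  2 * (a * b) + (2 * a + 2 * b + 2)         ≤⟨ +-monoˡ-≤ _ (2ab≤a²+b² a b) ⟩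
  a * a + b * b + (2 * a + 2 * b + 2)       ≡⟨ rhs a b ⟩
  suc a * suc a + suc b * suc b             ∎
  where
  open ≤-Reasoning
  lhs : ∀ a b → 2 * (suc a * suc b) ≡ 2 * (a * b) + (2 * a + 2 * b + 2)
  lhs = solve-∀
  rhs : ∀ a b → a * a + b * b + (2 * a + 2 * b + 2) ≡ suc a * suc a + suc b * suc b
  rhs = solve-∀

-- With V = a + b + c this is 3 C(V/3, 2) ≤ D cleared of denominators (convexity of k ↦ C(k, 2)).
sum-square-bound : ∀ a b c D → a C 2 + b C 2 + c C 2 ≤ D →
  (a + b + c) * (a + b + c) ≤ 6 * D + 3 * (a + b + c)
sum-square-bound a b c D h = begin
  (a + b + c) * (a + b + c)
    ≡⟨ expand a b c ⟩
  a * a + b * b + c * c + (2 * (a * b) + 2 * (a * c) + 2 * (b * c))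
    ≤⟨ +-monoʳ-≤ (a * a + b * b + c * c) (+-mono-≤ (+-mono-≤ (2ab≤a²+b² a b) (2ab≤a²+b² a c)) (2ab≤a²+b² b c)) ⟩
  a * a + b * b + c * c + ((a * a + b * b) + (a * a + c * c) + (b * b + c * c))
    ≡⟨ collect a b c ⟩
  3 * (a * a + b * b + c * c)
    ≡⟨ cong (3 *_) (sym (cong₂ _+_ (cong₂ _+_ (2*C2+k≡k*k a) (2*C2+k≡k*k b)) (2*C2+k≡k*k c))) ⟩
  3 * ((2 * (a C 2) + a) + (2 * (b C 2) + b) + (2 * (c C 2) + c))
    ≡⟨ distribute a b c (a C 2) (b C 2) (c C 2) ⟩
  6 * (a C 2 + b C 2 + c C 2) + 3 * (a + b + c)
    ≤⟨ +-monoˡ-≤ _ (*-monoʳ-≤ 6 h) ⟩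
  6 * D + 3 * (a + b + c) ∎
  where
  open ≤-Reasoning
  expand : ∀ a b c → (a + b + c) * (a + b + c) ≡ a * a + b * b + c * c + (2 * (a * b) + 2 * (a * c) + 2 * (b * c))
  expand = solve-∀
  collect : ∀ a b c → a * a + b * b + c * c + ((a * a + b * b) + (a * a + c * c) + (b * b + c * c)) ≡ 3 * (a * a + b * b + c * c)
  collect = solve-∀
  distribute : ∀ a b c x y z → 3 * ((2 * x + a) + (2 * y + b) + (2 * z + c)) ≡ 6 * (x + y + z) + 3 * (a + b + c)
  distribute = solve-∀

halves-overlap : ∀ {n a b} → a + b + 1 ≤ n → n ≤ 2 * a → n ≤ 2 * b → ⊥
halves-overlap {n} {a} {b} a+b<n n≤2a n≤2b = <-irrefl refl (begin-strict
  n + n                         ≤⟨ +-mono-≤ n≤2a n≤2b ⟩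
  2 * a + 2 * b                 <⟨ m<m+n _ (s≤s z≤n) ⟩
  2 * a + 2 * b + 2             ≡⟨ double a b ⟩
  (a + b + 1) + (a + b + 1)     ≤⟨ +-mono-≤ a+b<n a+b<n ⟩
  n + n                         ∎)
  where
  open ≤-Reasoning
  double : ∀ a b → 2 * a + 2 * b + 2 ≡ (a + b + 1) + (a + b + 1)
  double = solve-∀

a+b<n⇒b≤n∸a∸1 : ∀ {a b n} → a + b + 1 ≤ n → b ≤ n ∸ a ∸ 1
a+b<n⇒b≤n∸a∸1 {a} {b} a+b<n = m+n≤o⇒m≤o∸n b (m+n≤o⇒m≤o∸n (b + 1) (≤-trans (≤-reflexive (reorder a b)) a+b<n))
  where
  reorder : ∀ a b → b + 1 + a ≡ a + b + 1
  reorder = solve-∀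

∈-─⁺ : ∀ {A : Set} {x y : A} {xs} (y∈xs : y ∈ xs) → x ∈ xs → x ≢ y → x ∈ (xs ─ y∈xs)
∈-─⁺ (here refl)  (here refl)  x≢y = contradiction refl x≢y
∈-─⁺ (here refl)  (there x∈xs) _   = x∈xs
∈-─⁺ (there y∈xs) (here refl)  _   = here refl
∈-─⁺ (there y∈xs) (there x∈xs) x≢y = there (∈-─⁺ y∈xs x∈xs x≢y)

module _ {A : Set} where

  length-≤-injection : ∀ {B : Set} (R : A → B → Set) {xs : List A} {ys : List B} → Unique xs →
    (∀ {x} → x ∈ xs → ∃[ y ] y ∈ ys × R x y) →
    (∀ {x x′ y} → x ∈ xs → x′ ∈ xs → R x y → R x′ y → x ≡ x′) →
    length xs ≤ length ys
  length-≤-injection R {[]} _ _ _ = z≤n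
  length-≤-injection R {x ∷ xs} {ys} (x∉xs ∷ xs-unique) image injective
    with y , y∈ys , Rxy ← image (here refl) = begin
      suc (length xs)          ≤⟨ s≤s (length-≤-injection R xs-unique image′ (λ p q → injective (there p) (there q))) ⟩
      suc (length (ys ─ y∈ys)) ≡⟨ sym (length-removeAt′ ys (index y∈ys)) ⟩
      length ys                ∎
    where
    open ≤-Reasoning
    image′ : ∀ {x′} → x′ ∈ xs → ∃[ y′ ] y′ ∈ (ys ─ y∈ys) × R x′ y′
    image′ x′∈xs with y′ , y′∈ys , Rx′y′ ← image (there x′∈xs) =
      y′ , ∈-─⁺ y∈ys y′∈ys (λ { refl → All.lookup x∉xs x′∈xs (injective (here refl) (there x′∈xs) Rxy Rx′y′) }) , Rx′y′

  ⊆⇒length≤ : ∀ {xs ys : List A} → Unique xs → (∀ {x} → x ∈ xs → x ∈ ys) → length xs ≤ length ys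
  ⊆⇒length≤ xs-unique xs⊆ys =
    length-≤-injection _≡_ xs-unique (λ x∈xs → _ , xs⊆ys x∈xs , refl) (λ { _ _ refl refl → refl })

  module _ (_≟_ : DecidableEquality A) where
    open import Data.List.Membership.DecPropositional _≟_ using (_∈?_)

    ∃-∉ : ∀ {xs ys : List A} → Unique ys → length xs < length ys → ∃[ y ] y ∈ ys × y ∉ xs
    ∃-∉ {xs} {ys} ys-unique xs<ys with any? (λ y → ¬? (y ∈? xs)) ys
    ... | yes some = find some
    ... | no none = contradiction
      (⊆⇒length≤ ys-unique (λ y∈ys → decidable-stable (_ ∈? xs) (λ y∉xs → none (lose y∈ys y∉xs))))
      (<⇒≱ xs<ys)

  ∈-filterᵇ⁻ : ∀ (p : A → Bool) xs {x} → x ∈ filterᵇ p xs → x ∈ xs × T (p x)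
  ∈-filterᵇ⁻ p xs = ∈-filter⁻ (T? ∘ p) {xs = xs}

  length-filter-+ : ∀ (p q r : A → Bool) {xs} → Unique xs →
    (∀ {x} → x ∈ xs → T (p x) → T (q x) → ⊥) → (∀ {x} → x ∈ xs → T (p x) ⊎ T (q x) → T (r x)) →
    length (filterᵇ p xs) + length (filterᵇ q xs) ≤ length (filterᵇ r xs)
  length-filter-+ p q r {xs} xs-unique disjoint p∨q⇒r = begin
    length (filterᵇ p xs) + length (filterᵇ q xs) ≡⟨ sym (length-++ (filterᵇ p xs)) ⟩
    length (filterᵇ p xs ++ filterᵇ q xs)         ≤⟨ ⊆⇒length≤ p++q-unique p++q⊆r ⟩
    length (filterᵇ r xs)                         ∎
    where
    open ≤-Reasoning
    p++q-unique : Unique (filterᵇ p xs ++ filterᵇ q xs)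
    p++q-unique = Unique.++⁺ (Unique.filter⁺ (T? ∘ p) xs-unique) (Unique.filter⁺ (T? ∘ q) xs-unique)
      λ (x∈p , x∈q) → let x∈xs , px = ∈-filterᵇ⁻ p xs x∈p in disjoint x∈xs px (proj₂ (∈-filterᵇ⁻ q xs x∈q))
    p++q⊆r : ∀ {x} → x ∈ filterᵇ p xs ++ filterᵇ q xs → x ∈ filterᵇ r xs
    p++q⊆r x∈ with ∈-++⁻ (filterᵇ p xs) x∈
    ... | inj₁ x∈p = let x∈xs , px = ∈-filterᵇ⁻ p xs x∈p in ∈-filter⁺ (T? ∘ r) x∈xs (p∨q⇒r x∈xs (inj₁ px))
    ... | inj₂ x∈q = let x∈xs , qx = ∈-filterᵇ⁻ q xs x∈q in ∈-filter⁺ (T? ∘ r) x∈xs (p∨q⇒r x∈xs (inj₂ qx))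

  length-filter-≤-+ : ∀ (p q r : A → Bool) {xs} → Unique xs → (∀ {x} → x ∈ xs → T (r x) → T (p x) ⊎ T (q x)) →
    length (filterᵇ r xs) ≤ length (filterᵇ p xs) + length (filterᵇ q xs)
  length-filter-≤-+ p q r {xs} xs-unique r⇒p∨q = begin
    length (filterᵇ r xs)                         ≤⟨ ⊆⇒length≤ (Unique.filter⁺ (T? ∘ r) xs-unique) r⊆p++q ⟩
    length (filterᵇ p xs ++ filterᵇ q xs)         ≡⟨ length-++ (filterᵇ p xs) ⟩
    length (filterᵇ p xs) + length (filterᵇ q xs) ∎
    where
    open ≤-Reasoning
    r⊆p++q : ∀ {x} → x ∈ filterᵇ r xs → x ∈ filterᵇ p xs ++ filterᵇ q xs
    r⊆p++q x∈r with x∈xs , rx ← ∈-filterᵇ⁻ r xs x∈r with r⇒p∨q x∈xs rx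
    ... | inj₁ px = ∈-++⁺ˡ (∈-filter⁺ (T? ∘ p) x∈xs px)
    ... | inj₂ qx = ∈-++⁺ʳ (filterᵇ p xs) (∈-filter⁺ (T? ∘ q) x∈xs qx)

  pairs : List A → List (A × A)
  pairs []       = []
  pairs (x ∷ xs) = map (x ,_) xs ++ pairs xs

  length-pairs : ∀ xs → length (pairs xs) ≡ length xs C 2
  length-pairs []       = refl
  length-pairs (x ∷ xs) = begin
    length (map (x ,_) xs ++ pairs xs)          ≡⟨ length-++ (map (x ,_) xs) ⟩
    length (map (x ,_) xs) + length (pairs xs)  ≡⟨ cong₂ _+_ (length-map (x ,_) xs) (length-pairs xs) ⟩
    length xs + length xs C 2                   ≡⟨ sym (suc-C2 (length xs)) ⟩
    suc (length xs) C 2                         ∎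
    where open ≡-Reasoning

  ∈-pairs⁻ : ∀ xs {u v} → (u , v) ∈ pairs xs → u ∈ xs × v ∈ xs
  ∈-pairs⁻ (x ∷ xs) p with ∈-++⁻ (map (x ,_) xs) p
  ... | inj₁ q with _ , v∈xs , refl ← ∈-map⁻ (x ,_) q = here refl , there v∈xs
  ... | inj₂ q with u∈xs , v∈xs ← ∈-pairs⁻ xs q = there u∈xs , there v∈xs

  ∈-pairs⁺ : ∀ xs {u v} → u ∈ xs → v ∈ xs → u ≢ v → (u , v) ∈ pairs xs ⊎ (v , u) ∈ pairs xs
  ∈-pairs⁺ (x ∷ xs) (here refl) (here refl)  u≢v = contradiction refl u≢v
  ∈-pairs⁺ (x ∷ xs) (here refl) (there v∈xs) _   = inj₁ (∈-++⁺ˡ (∈-map⁺ (x ,_) v∈xs))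
  ∈-pairs⁺ (x ∷ xs) (there u∈xs) (here refl) _   = inj₂ (∈-++⁺ˡ (∈-map⁺ (x ,_) u∈xs))
  ∈-pairs⁺ (x ∷ xs) (there u∈xs) (there v∈xs) u≢v with ∈-pairs⁺ xs u∈xs v∈xs u≢v
  ... | inj₁ p = inj₁ (∈-++⁺ʳ (map (x ,_) xs) p)
  ... | inj₂ p = inj₂ (∈-++⁺ʳ (map (x ,_) xs) p)

  pairs-unique : ∀ {xs} → Unique xs → Unique (pairs xs)
  pairs-unique {[]}     _                    = []
  pairs-unique {x ∷ xs} (x∉xs ∷ xs-unique) =
    Unique.++⁺ (Unique.map⁺ (cong proj₂) xs-unique) (pairs-unique xs-unique) first-differs
    where
    first-differs : ∀ {p} → ¬ (p ∈ map (x ,_) xs × p ∈ pairs xs)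
    first-differs (p∈ , p∈pairs) with _ , _ , refl ← ∈-map⁻ (x ,_) p∈ =
      All.lookup x∉xs (proj₁ (∈-pairs⁻ xs p∈pairs)) refl

  pairs-≢ : ∀ {xs u v} → Unique xs → (u , v) ∈ pairs xs → u ≢ v
  pairs-≢ {x ∷ xs} (x∉xs ∷ xs-unique) p with ∈-++⁻ (map (x ,_) xs) p
  ... | inj₁ q with _ , v∈xs , refl ← ∈-map⁻ (x ,_) q = All.lookup x∉xs v∈xs
  ... | inj₂ q = pairs-≢ xs-unique q

  pairs-asym : ∀ {xs u v} → Unique xs → (u , v) ∈ pairs xs → (v , u) ∈ pairs xs → ⊥
  pairs-asym {x ∷ xs} (x∉xs ∷ xs-unique) p q with ∈-++⁻ (map (x ,_) xs) p | ∈-++⁻ (map (x ,_) xs) q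
  ... | inj₁ p′ | inj₁ q′ with _ , v∈xs , refl ← ∈-map⁻ (x ,_) p′ | _ , _ , refl ← ∈-map⁻ (x ,_) q′ =
    All.lookup x∉xs v∈xs refl
  ... | inj₁ p′ | inj₂ q′ with _ , _ , refl ← ∈-map⁻ (x ,_) p′ = All.lookup x∉xs (proj₂ (∈-pairs⁻ xs q′)) refl
  ... | inj₂ p′ | inj₁ q′ with _ , _ , refl ← ∈-map⁻ (x ,_) q′ = All.lookup x∉xs (proj₂ (∈-pairs⁻ xs p′)) refl
  ... | inj₂ p′ | inj₂ q′ = pairs-asym xs-unique p′ q′

  pairs-≡ : ∀ {xs u v u′ v′} → Unique xs → (u , v) ∈ pairs xs → (u′ , v′) ∈ pairs xs →
    u′ ∈ u ∷ v ∷ [] → v′ ∈ u ∷ v ∷ [] → (u , v) ≡ (u′ , v′)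
  pairs-≡ xs-unique p q (here refl)         (there (here refl)) = refl
  pairs-≡ xs-unique p q (here refl)         (here refl)         = contradiction refl (pairs-≢ xs-unique q)
  pairs-≡ xs-unique p q (there (here refl)) (there (here refl)) = contradiction refl (pairs-≢ xs-unique q)
  pairs-≡ xs-unique p q (there (here refl)) (here refl)         = ⊥-elim (pairs-asym xs-unique p q)

T-∧⁻ : ∀ x {y} → T (x ∧ y) → T x × T y
T-∧⁻ x = Equivalence.to (T-∧ {x})

T-∧⁺ : ∀ {x y} → T x → T y → T (x ∧ y)
T-∧⁺ {x} tx ty = Equivalence.from (T-∧ {x}) (tx , ty)

T-∨⁻ : ∀ x {y} → T (x ∨ y) → T x ⊎ T y
T-∨⁻ x = Equivalence.to (T-∨ {x})

T-not⁻ : ∀ x → T (not x) → ¬ T x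
T-not⁻ true ()

T-not⁺ : ∀ {x} → ¬ T x → T (not x)
T-not⁺ {true}  ¬tx = ¬tx tt
T-not⁺ {false} _   = tt

module _ {n : ℕ} where

  open import Data.List.Membership.DecPropositional (_≟_ {n}) using (_∈?_)

  members : (Fin n → Bool) → List (Fin n)
  members p = filterᵇ p (allFin n)

  members-unique : ∀ p → Unique (members p)
  members-unique p = Unique.filter⁺ (T? ∘ p) (allFin⁺ n)

  ∈-members⁺ : ∀ {p v} → T (p v) → v ∈ members p
  ∈-members⁺ {p} {v} = ∈-filter⁺ (T? ∘ p) (∈-allFin v)

  ∈-members⁻ : ∀ {p v} → v ∈ members p → T (p v)
  ∈-members⁻ {p} = proj₂ ∘ ∈-filterᵇ⁻ p (allFin n)

  ∈ₛ⇒T : ∀ {p : Subset n} {x} → x ∈ₛ p → T (lookup p x)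
  ∈ₛ⇒T x∈p rewrite []=⇒lookup x∈p = tt

  T⇒∈ₛ : ∀ {p : Subset n} {x} → T (lookup p x) → x ∈ₛ p
  T⇒∈ₛ {p} {x} t with lookup p x in eq
  ... | true = lookup⇒[]= x p eq

  ∣p∣≡length-members : ∀ (p : Subset n) → ∣ p ∣ ≡ length (members (lookup p))
  ∣p∣≡length-members p = count p id (λ _ → refl)
    where
    count : ∀ {m} {A : Set} (p : Subset m) {q : A → Bool} (f : Fin m → A) → (∀ i → q (f i) ≡ lookup p i) →
      ∣ p ∣ ≡ length (filterᵇ q (tabulate f))
    count []      f q∘f≗p = refl
    count (b ∷ p) f q∘f≗p rewrite q∘f≗p Fin.zero with b
    ... | true  = cong suc (count p (f ∘ Fin.suc) (q∘f≗p ∘ Fin.suc))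
    ... | false = count p (f ∘ Fin.suc) (q∘f≗p ∘ Fin.suc)

  length≤∣p∣ : ∀ {p : Subset n} {xs} → Unique xs → (∀ {x} → x ∈ xs → x ∈ₛ p) → length xs ≤ ∣ p ∣
  length≤∣p∣ {p} xs-unique xs⊆p = ≤-trans
    (⊆⇒length≤ xs-unique (∈-members⁺ {p = lookup p} ∘ ∈ₛ⇒T ∘ xs⊆p)) (≤-reflexive (sym (∣p∣≡length-members p)))

  ∣p∣≤length : ∀ {p : Subset n} {xs} → (∀ {x} → x ∈ₛ p → x ∈ xs) → ∣ p ∣ ≤ length xs
  ∣p∣≤length {p} p⊆xs = ≤-trans
    (≤-reflexive (∣p∣≡length-members p)) (⊆⇒length≤ (members-unique (lookup p)) (p⊆xs ∘ T⇒∈ₛ ∘ ∈-members⁻))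

  ∃-∉ₛ : ∀ {p : Subset n} {xs} → length xs < ∣ p ∣ → ∃[ x ] x ∈ₛ p × x ∉ xs
  ∃-∉ₛ {p} xs<p with x , x∈p , x∉xs ← ∃-∉ _≟_ (members-unique (lookup p)) (≤-trans xs<p (≤-reflexive (∣p∣≡length-members p))) =
    x , T⇒∈ₛ (∈-members⁻ x∈p) , x∉xs

  ∈ₛ-enumeration : ∀ {p : Subset n} {xs x} → Unique xs → ∣ p ∣ ≤ length xs →
    (∀ {y} → y ∈ xs → y ∈ₛ p) → x ∈ₛ p → x ∈ xs
  ∈ₛ-enumeration {p} {xs} {x} xs-unique ∣p∣≤xs xs⊆p x∈p with x ∈? xs
  ... | yes x∈xs = x∈xs
  ... | no x∉xs  = contradiction
    (length≤∣p∣ (¬Any⇒All¬ xs x∉xs ∷ xs-unique) λ { (here refl) → x∈p ; (there y∈xs) → xs⊆p y∈xs })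
    (<⇒≱ (s≤s ∣p∣≤xs))

module Shadow {n : ℕ} (F : List (Subset n)) where

  Edge : Fin n → Fin n → Set
  Edge u v = T (shadowEdge F u v)

  ≠ᵇ⁺ : ∀ {x y} → x ≢ y → T (_≠ᵇ_ F x y)
  ≠ᵇ⁺ = fromWitnessFalse

  edge⁺ : ∀ {S u v} → S ∈ F → u ∈ₛ S → v ∈ₛ S → u ≢ v → Edge u v
  edge⁺ S∈F u∈S v∈S u≢v = T-∧⁺ (≠ᵇ⁺ u≢v) (any⁺ _ (lose S∈F (T-∧⁺ (∈ₛ⇒T u∈S) (∈ₛ⇒T v∈S))))

  edge⁻ : ∀ {u v} → Edge u v → u ≢ v × ∃[ S ] S ∈ F × u ∈ₛ S × v ∈ₛ S
  edge⁻ {u} {v} e with u≠v , shared ← T-∧⁻ (_≠ᵇ_ F u v) e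
                  with S , S∈F , uv∈S ← find (any⁻ _ F shared)
                  with u∈S , v∈S ← T-∧⁻ (lookup S u) uv∈S =
    toWitnessFalse u≠v , S , S∈F , T⇒∈ₛ u∈S , T⇒∈ₛ v∈S

  edge-sym : ∀ {u v} → Edge u v → Edge v u
  edge-sym e with u≢v , S , S∈F , u∈S , v∈S ← edge⁻ e = edge⁺ S∈F v∈S u∈S (u≢v ∘ sym)

  edge-irrefl : ∀ {u} → ¬ Edge u u
  edge-irrefl e = proj₁ (edge⁻ e) refl

  coEdge⁺ : ∀ {u v} → u ≢ v → ¬ Edge u v → T (coEdge F u v)
  coEdge⁺ u≢v ¬uv = T-∧⁺ (≠ᵇ⁺ u≢v) (T-not⁺ ¬uv)

  coEdge⁻ : ∀ {u v} → T (coEdge F u v) → ¬ Edge u v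
  coEdge⁻ {u} {v} t = T-not⁻ _ (proj₂ (T-∧⁻ (_≠ᵇ_ F u v) t))

  ∈triple⁻ : ∀ {a b c x} → x ∈ₛ triple F a b c → x ∈ a ∷ b ∷ c ∷ []
  ∈triple⁻ {a} {b} {c} x∈ with x∈p∪q⁻ ⁅ a ⁆ (⁅ b ⁆ ∪ ⁅ c ⁆) x∈
  ... | inj₁ x∈a  = here (x∈⁅y⁆⇒x≡y a x∈a)
  ... | inj₂ x∈bc with x∈p∪q⁻ ⁅ b ⁆ ⁅ c ⁆ x∈bc
  ... | inj₁ x∈b = there (here (x∈⁅y⁆⇒x≡y b x∈b))
  ... | inj₂ x∈c = there (there (here (x∈⁅y⁆⇒x≡y c x∈c)))

  ∈triple⁺ : ∀ {a b c x} → x ∈ a ∷ b ∷ c ∷ [] → x ∈ₛ triple F a b c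
  ∈triple⁺ (here refl)                 = x∈p∪q⁺ (inj₁ (x∈⁅x⁆ _))
  ∈triple⁺ (there (here refl))         = x∈p∪q⁺ (inj₂ (x∈p∪q⁺ (inj₁ (x∈⁅x⁆ _))))
  ∈triple⁺ (there (there (here refl))) = x∈p∪q⁺ (inj₂ (x∈p∪q⁺ (inj₂ (x∈⁅x⁆ _))))

  nbrsIn : Subset n → Fin n → List (Fin n)
  nbrsIn S v = members (λ u → lookup S u ∧ shadowEdge F u v)

  -- The predicate counted by Val, so that Val F S and length (uniqueNbrs S) agree by definition.
  uniqueNbrᵇ : Subset n → Fin n → Bool
  uniqueNbrᵇ S v = not (lookup S v) ∧ (length (nbrsIn S v) ≡ᵇ 1)

  UniqueNbr : Subset n → Fin n → Set
  UniqueNbr S v = T (uniqueNbrᵇ S v)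

  uniqueNbrs : Subset n → List (Fin n)
  uniqueNbrs S = members (uniqueNbrᵇ S)

  ∈-nbrsIn⁺ : ∀ {S u v} → u ∈ₛ S → Edge u v → u ∈ nbrsIn S v
  ∈-nbrsIn⁺ u∈S uv = ∈-members⁺ (T-∧⁺ (∈ₛ⇒T u∈S) uv)

  ∈-nbrsIn⁻ : ∀ {S u v} → u ∈ nbrsIn S v → u ∈ₛ S × Edge u v
  ∈-nbrsIn⁻ {S} {u} u∈nbrs with u∈S , uv ← T-∧⁻ (lookup S u) (∈-members⁻ u∈nbrs) = T⇒∈ₛ u∈S , uv

  nbrsIn-unique : ∀ S v → Unique (nbrsIn S v)
  nbrsIn-unique S v = members-unique _

  uniqueNbr⁻ : ∀ {S v} → UniqueNbr S v → v ∉ₛ S × ∃[ u ] u ∈ₛ S × Edge u v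
  uniqueNbr⁻ {S} {v} h
    with v∉S , one ← T-∧⁻ (not (lookup S v)) h
    with u , u∈nbrs , _ ← ∃-∉ _≟_ {xs = []} (nbrsIn-unique S v) (≤-reflexive (sym (≡ᵇ⇒≡ _ 1 one))) =
    T-not⁻ _ v∉S ∘ ∈ₛ⇒T , u , ∈-nbrsIn⁻ u∈nbrs

  two-nbrs⇒¬uniqueNbr : ∀ {S a b v} → a ≢ b → a ∈ₛ S → b ∈ₛ S → Edge a v → Edge b v → ¬ UniqueNbr S v
  two-nbrs⇒¬uniqueNbr {S} {a} {b} {v} a≢b a∈S b∈S av bv h = <-irrefl (sym (≡ᵇ⇒≡ _ 1 one)) two≤nbrs
    where
    one = proj₂ (T-∧⁻ (not (lookup S v)) h)
    two≤nbrs : 2 ≤ length (nbrsIn S v)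
    two≤nbrs = ⊆⇒length≤ {ys = nbrsIn S v} ((a≢b ∷ []) ∷ [] ∷ []) λ
      { (here refl) → ∈-nbrsIn⁺ a∈S av ; (there (here refl)) → ∈-nbrsIn⁺ b∈S bv }

  uniqueNbr⁺ : ∀ {S e v} → v ∉ₛ S → e ∈ₛ S → Edge e v → (∀ {u} → u ∈ₛ S → Edge u v → u ≡ e) → UniqueNbr S v
  uniqueNbr⁺ {S} {e} {v} v∉S e∈S ev only-e =
    T-∧⁺ (T-not⁺ (v∉S ∘ T⇒∈ₛ)) (≡⇒≡ᵇ _ 1 (≤-antisym at-most-one at-least-one))
    where
    at-most-one : length (nbrsIn S v) ≤ 1
    at-most-one = ⊆⇒length≤ {ys = e ∷ []} (nbrsIn-unique S v) λ u∈nbrs →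
      let u∈S , uv = ∈-nbrsIn⁻ u∈nbrs in here (only-e u∈S uv)
    at-least-one : 1 ≤ length (nbrsIn S v)
    at-least-one = ⊆⇒length≤ {ys = nbrsIn S v} ([] ∷ []) λ { (here refl) → ∈-nbrsIn⁺ e∈S ev }

  uniqueNbr-misses : ∀ {R p q v} → UniqueNbr R v → p ≢ q → p ∈ₛ R → q ∈ₛ R → ∃[ x ] x ∈ p ∷ q ∷ [] × ¬ Edge x v
  uniqueNbr-misses {p = p} {q} {v} unique p≢q p∈R q∈R with T? (shadowEdge F p v)
  ... | no ¬pv = p , here refl , ¬pv
  ... | yes pv = q , there (here refl) , λ qv → two-nbrs⇒¬uniqueNbr p≢q p∈R q∈R pv qv unique

  record C4Witness (S S′ : Subset n) : Set where
    field
      a b c d : Fin n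
      a∈S : a ∈ₛ S
      b∈S : b ∈ₛ S
      c∈S′ : c ∈ₛ S′
      d∈S′ : d ∈ₛ S′
      a≢b : a ≢ b
      a≢c : a ≢ c
      a≢d : a ≢ d
      b≢c : b ≢ c
      b≢d : b ≢ d
      c≢d : c ≢ d
      ¬ac : ¬ Edge a c
      ¬ad : ¬ Edge a d
      ¬bc : ¬ Edge b c
      ¬bd : ¬ Edge b d

  anyV⁺ : ∀ {p : Fin n → Bool} x → T (p x) → T (anyV F p)
  anyV⁺ {p} x px = any⁺ {xs = allFin n} p (lose (∈-allFin x) px)

  anyV⁻ : ∀ {p : Fin n → Bool} → T (anyV F p) → ∃[ x ] T (p x)
  anyV⁻ {p} t with x , _ , px ← find (any⁻ p (allFin n) t) = x , px

  adj⁺ : ∀ {S S′} → C4Witness S S′ → Adj F S S′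
  adj⁺ {S} {S′} w = Equivalence.to T-≡ (anyV⁺ a (anyV⁺ b (anyV⁺ c (anyV⁺ d spans))))
    where
    open C4Witness w
    distinct : T (distinct4 F a b c d)
    distinct = T-∧⁺ (≠ᵇ⁺ a≢b) (T-∧⁺ (≠ᵇ⁺ a≢c) (T-∧⁺ (≠ᵇ⁺ a≢d)
      (T-∧⁺ (≠ᵇ⁺ b≢c) (T-∧⁺ (≠ᵇ⁺ b≢d) (≠ᵇ⁺ c≢d)))))
    cycle-acbd : T (cycleCo F a c b d)
    cycle-acbd = T-∧⁺ (coEdge⁺ a≢c ¬ac) (T-∧⁺ (coEdge⁺ (b≢c ∘ sym) (¬bc ∘ edge-sym))
      (T-∧⁺ (coEdge⁺ b≢d ¬bd) (coEdge⁺ (a≢d ∘ sym) (¬ad ∘ edge-sym))))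
    spans : T (lookup S a ∧ (lookup S b ∧ (lookup S′ c ∧ (lookup S′ d ∧ spansC4co F a b c d))))
    spans = T-∧⁺ (∈ₛ⇒T a∈S) (T-∧⁺ (∈ₛ⇒T b∈S) (T-∧⁺ (∈ₛ⇒T c∈S′) (T-∧⁺ (∈ₛ⇒T d∈S′)
      (T-∧⁺ distinct (Equivalence.from (T-∨ {cycleCo F a b c d}) (inj₂ (Equivalence.from (T-∨ {cycleCo F a c b d}) (inj₁ cycle-acbd))))))))

  -- deg F S is length (filterᵇ (adjacentᵇ S) F) by definition.
  adjacentᵇ : Subset n → Subset n → Bool
  adjacentᵇ S S′ = crossAB F S S′ ∧ adjᵇ F S S′

  distinct4⁻ : ∀ {a b c d} → T (distinct4 F a b c d) → a ≢ b × a ≢ c × a ≢ d × b ≢ c × b ≢ d × c ≢ d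
  distinct4⁻ {a} {b} {c} {d} t
    with a≢b , t ← T-∧⁻ (_≠ᵇ_ F a b) t
    with a≢c , t ← T-∧⁻ (_≠ᵇ_ F a c) t
    with a≢d , t ← T-∧⁻ (_≠ᵇ_ F a d) t
    with b≢c , t ← T-∧⁻ (_≠ᵇ_ F b c) t
    with b≢d , c≢d ← T-∧⁻ (_≠ᵇ_ F b d) t =
    toWitnessFalse a≢b , toWitnessFalse a≢c , toWitnessFalse a≢d ,
    toWitnessFalse b≢c , toWitnessFalse b≢d , toWitnessFalse c≢d

  cycleCo⁻ : ∀ {p q r s} → T (cycleCo F p q r s) → ¬ Edge p q × ¬ Edge q r × ¬ Edge r s × ¬ Edge s p
  cycleCo⁻ {p} {q} {r} {s} t
    with pq , t ← T-∧⁻ (coEdge F p q) t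
    with qr , t ← T-∧⁻ (coEdge F q r) t
    with rs , sp ← T-∧⁻ (coEdge F r s) t =
    coEdge⁻ pq , coEdge⁻ qr , coEdge⁻ rs , coEdge⁻ sp

  -- Of the three 4-cycles on {a, b, c, d} only a-c-b-d-a avoids the edge ab of S.
  adj⁻ : ∀ {S S′} → S ∈ F → Adj F S S′ → C4Witness S S′
  adj⁻ {S} {S′} S∈F adj
    with a , t ← anyV⁻ (Equivalence.from T-≡ adj)
    with b , t ← anyV⁻ t
    with c , t ← anyV⁻ t
    with d , t ← anyV⁻ t
    with a∈S , t ← T-∧⁻ (lookup S a) t
    with b∈S , t ← T-∧⁻ (lookup S b) t
    with c∈S′ , t ← T-∧⁻ (lookup S′ c) t
    with d∈S′ , t ← T-∧⁻ (lookup S′ d) t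
    with distinct , cycles ← T-∧⁻ (distinct4 F a b c d) t
    with a≢b , a≢c , a≢d , b≢c , b≢d , c≢d ← distinct4⁻ distinct
    with T-∨⁻ (cycleCo F a b c d) cycles
  ... | inj₁ abcd = contradiction (edge⁺ S∈F (T⇒∈ₛ a∈S) (T⇒∈ₛ b∈S) a≢b) (proj₁ (cycleCo⁻ abcd))
  ... | inj₂ cycles′ with T-∨⁻ (cycleCo F a c b d) cycles′
  ... | inj₂ abdc = contradiction (edge⁺ S∈F (T⇒∈ₛ a∈S) (T⇒∈ₛ b∈S) a≢b) (proj₁ (cycleCo⁻ abdc))
  ... | inj₁ acbd with ¬ac , ¬cb , ¬bd , ¬da ← cycleCo⁻ acbd = record
    { a = a ; b = b ; c = c ; d = d
    ; a∈S = T⇒∈ₛ a∈S ; b∈S = T⇒∈ₛ b∈S ; c∈S′ = T⇒∈ₛ c∈S′ ; d∈S′ = T⇒∈ₛ d∈S′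
    ; a≢b = a≢b ; a≢c = a≢c ; a≢d = a≢d ; b≢c = b≢c ; b≢d = b≢d ; c≢d = c≢d
    ; ¬ac = ¬ac ; ¬ad = ¬da ∘ edge-sym ; ¬bc = ¬cb ∘ edge-sym ; ¬bd = ¬bd }

module LinearTripleSystem {n : ℕ} {F : List (Subset n)} (triples : IsTripleSystem F) (linear : IsLinear F) where

  open Shadow F

  ∣S∣≡3 : ∀ {S} → S ∈ F → ∣ S ∣ ≡ 3
  ∣S∣≡3 = All.lookup (proj₁ triples)

  some-vertex : ∀ {S} → S ∈ F → ∃[ x ] x ∈ₛ S
  some-vertex S∈F with x , x∈S , _ ← ∃-∉ₛ {xs = []} (≤-trans (s≤s z≤n) (≤-reflexive (sym (∣S∣≡3 S∈F)))) = x , x∈S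

  third-vertex : ∀ {S} a b → S ∈ F → ∃[ e ] e ∈ₛ S × e ≢ a × e ≢ b
  third-vertex a b S∈F with e , e∈S , e∉ab ← ∃-∉ₛ {xs = a ∷ b ∷ []} (≤-reflexive (sym (∣S∣≡3 S∈F))) =
    e , e∈S , e∉ab ∘ here , e∉ab ∘ there ∘ here

  other-vertices : ∀ {S t} → S ∈ F → t ∈ₛ S → ∃[ s₁ ] ∃[ s₂ ] Unique (t ∷ s₁ ∷ s₂ ∷ []) × s₁ ∈ₛ S × s₂ ∈ₛ S
  other-vertices {t = t} S∈F t∈S
    with s₁ , s₁∈S , s₁≢t , _ ← third-vertex t t S∈F
    with s₂ , s₂∈S , s₂≢t , s₂≢s₁ ← third-vertex t s₁ S∈F =
    s₁ , s₂ , ((s₁≢t ∘ sym) ∷ (s₂≢t ∘ sym) ∷ []) ∷ ((s₂≢s₁ ∘ sym) ∷ []) ∷ [] ∷ [] , s₁∈S , s₂∈S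

  vertices : ∀ {S a b c u} → S ∈ F → Unique (a ∷ b ∷ c ∷ []) → a ∈ₛ S → b ∈ₛ S → c ∈ₛ S →
    u ∈ₛ S → u ∈ a ∷ b ∷ c ∷ []
  vertices S∈F abc-unique a∈S b∈S c∈S = ∈ₛ-enumeration abc-unique (≤-reflexive (∣S∣≡3 S∈F)) λ
    { (here refl) → a∈S ; (there (here refl)) → b∈S ; (there (there (here refl))) → c∈S }

  ≡triple : ∀ {S a b c} → S ∈ F → Unique (a ∷ b ∷ c ∷ []) → a ∈ₛ S → b ∈ₛ S → c ∈ₛ S → S ≡ triple F a b c
  ≡triple S∈F abc-unique a∈S b∈S c∈S = ⊆-antisym
    (∈triple⁺ ∘ vertices S∈F abc-unique a∈S b∈S c∈S)
    (λ x∈ → case ∈triple⁻ x∈ of λ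
      { (here refl) → a∈S ; (there (here refl)) → b∈S ; (there (there (here refl))) → c∈S })

  linear-≡ : ∀ {S S′ a b} → S ∈ F → S′ ∈ F → a ≢ b → a ∈ₛ S → b ∈ₛ S → a ∈ₛ S′ → b ∈ₛ S′ → S ≡ S′
  linear-≡ {S} {S′} S∈F S′∈F a≢b a∈S b∈S a∈S′ b∈S′ = decidable-stable (≡-dec Bool._≟_ S S′) λ S≢S′ →
    ≤⇒≯ (linear S S′ S∈F S′∈F S≢S′) (length≤∣p∣ ((a≢b ∷ []) ∷ [] ∷ []) λ
      { (here refl) → x∈p∩q⁺ (a∈S , a∈S′) ; (there (here refl)) → x∈p∩q⁺ (b∈S , b∈S′) })

  uniqueNbr-of-triple : ∀ {S a b e x} → S ∈ F → Unique (a ∷ b ∷ e ∷ []) → a ∈ₛ S → b ∈ₛ S → e ∈ₛ S →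
    a ≢ x → ¬ Edge a x → ¬ Edge b x → Edge e x → UniqueNbr S x
  uniqueNbr-of-triple S∈F abe-unique a∈S b∈S e∈S a≢x ¬ax ¬bx ex =
    uniqueNbr⁺ (λ x∈S → ¬ax (edge⁺ S∈F a∈S x∈S a≢x)) e∈S ex λ u∈S ux →
      case vertices S∈F abe-unique a∈S b∈S e∈S u∈S of λ
        { (here refl) → contradiction ux ¬ax
        ; (there (here refl)) → contradiction ux ¬bx
        ; (there (there (here refl))) → refl }

  PairIn : Fin n × Fin n → Subset n → Set
  PairIn (u , v) S = S ∈ F × u ≢ v × u ∈ₛ S × v ∈ₛ S

  PairIn-injective : ∀ {q S S′} → PairIn q S → PairIn q S′ → S ≡ S′
  PairIn-injective (S∈F , u≢v , u∈S , v∈S) (S′∈F , _ , u∈S′ , v∈S′) = linear-≡ S∈F S′∈F u≢v u∈S v∈S u∈S′ v∈S′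

module Spreading {n : ℕ} {F : List (Subset n)} (triples : IsTripleSystem F) (linear : IsLinear F)
                 (spreading : IsSpreading F) (4<n : 4 < n) where

  open Shadow F
  open LinearTripleSystem triples linear
  open import Data.List.Membership.DecPropositional (_≟_ {n}) using (_∈?_)

  ¬small-closure : ∀ {V′ W} → Nontrivial F V′ → IsClosure F V′ W → ∣ W ∣ ≤ 4 → ⊥
  ¬small-closure nontrivial closure ∣W∣≤4 with refl ← spreading _ nontrivial _ closure =
    <⇒≱ 4<n (≤-trans (≤-reflexive (sym (∣⊤∣≡n n))) ∣W∣≤4)

  nontrivial-triple : ∀ {x y z} → Unique (x ∷ y ∷ z ∷ []) → ¬ Edge x y → Nontrivial F (triple F x y z)
  nontrivial-triple xyz-unique@((x≢y ∷ _) ∷ _) ¬xy =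
    length≤∣p∣ xyz-unique ∈triple⁺ ,
    λ xyz∈F → ¬xy (edge⁺ xyz∈F (∈triple⁺ (here refl)) (∈triple⁺ (there (here refl))) x≢y)

  -- Three pairwise non-adjacent vertices would form a nontrivial closed set.
  coTriangle-free : ∀ {u v w} → Unique (u ∷ v ∷ w ∷ []) → ¬ Edge u v → ¬ Edge v w → ¬ Edge u w → ⊥
  coTriangle-free {u} {v} {w} uvw-unique ¬uv ¬vw ¬uw =
    ¬small-closure (nontrivial-triple uvw-unique ¬uv) (id , closed , λ _ V′⊆W′ _ → V′⊆W′)
      (≤-trans (∣p∣≤length {p = triple F u v w} ∈triple⁻) (n≤1+n 3))
    where
    independent : ∀ {x y} → x ∈ u ∷ v ∷ w ∷ [] → y ∈ u ∷ v ∷ w ∷ [] → ¬ Edge x y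
    independent (here refl)                 (here refl)                 = edge-irrefl
    independent (here refl)                 (there (here refl))         = ¬uv
    independent (here refl)                 (there (there (here refl))) = ¬uw
    independent (there (here refl))         (here refl)                 = ¬uv ∘ edge-sym
    independent (there (here refl))         (there (here refl))         = edge-irrefl
    independent (there (here refl))         (there (there (here refl))) = ¬vw
    independent (there (there (here refl))) (here refl)                 = ¬uw ∘ edge-sym
    independent (there (there (here refl))) (there (here refl))         = ¬vw ∘ edge-sym
    independent (there (there (here refl))) (there (there (here refl))) = edge-irrefl
    closed : NEmpty F (triple F u v w)
    closed x y z x∈ y∈ x≢y _ xyz∈F = independent (∈triple⁻ x∈) (∈triple⁻ y∈)
      (edge⁺ xyz∈F (∈triple⁺ (here refl)) (∈triple⁺ (there (here refl))) x≢y)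

  closure-of-non-neighbour : ∀ {S u v w y} → S ∈ F → Unique (u ∷ v ∷ w ∷ []) →
    u ∈ₛ S → v ∈ₛ S → w ∈ₛ S → ¬ Edge y u → ¬ Edge y v → ¬ Edge y w →
    IsClosure F (triple F y u v) (triple F y u v ∪ ⁅ w ⁆)
  closure-of-non-neighbour {S} {u} {v} {w} {y} S∈F uvw-unique@((u≢v ∷ _) ∷ _) u∈S v∈S w∈S ¬yu ¬yv ¬yw =
    p⊆p∪q ⁅ w ⁆ , closed , minimal
    where
    V′ = triple F y u v
    classify : ∀ {x} → x ∈ₛ V′ ∪ ⁅ w ⁆ → x ≡ y ⊎ (x ∈ₛ S × ¬ Edge y x)
    classify x∈ with x∈p∪q⁻ V′ ⁅ w ⁆ x∈
    ... | inj₂ x∈w with refl ← x∈⁅y⁆⇒x≡y w x∈w = inj₂ (w∈S , ¬yw)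
    ... | inj₁ x∈V′ with ∈triple⁻ x∈V′
    ... | here refl                 = inj₁ refl
    ... | there (here refl)         = inj₂ (u∈S , ¬yu)
    ... | there (there (here refl)) = inj₂ (v∈S , ¬yv)
    S⊆W : ∀ {x} → x ∈ₛ S → x ∈ₛ V′ ∪ ⁅ w ⁆
    S⊆W x∈S with vertices S∈F uvw-unique u∈S v∈S w∈S x∈S
    ... | here refl                 = p⊆p∪q ⁅ w ⁆ (∈triple⁺ (there (here refl)))
    ... | there (here refl)         = p⊆p∪q ⁅ w ⁆ (∈triple⁺ (there (there (here refl))))
    ... | there (there (here refl)) = q⊆p∪q V′ ⁅ w ⁆ (x∈⁅x⁆ w)
    closed : NEmpty F (V′ ∪ ⁅ w ⁆)
    closed x₁ x₂ z x₁∈ x₂∈ x₁≢x₂ z∉W x₁x₂z∈F with classify x₁∈ | classify x₂∈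
    ... | inj₁ refl         | inj₁ refl         = x₁≢x₂ refl
    ... | inj₁ refl         | inj₂ (_ , ¬yx₂)   =
      ¬yx₂ (edge⁺ x₁x₂z∈F (∈triple⁺ (here refl)) (∈triple⁺ (there (here refl))) x₁≢x₂)
    ... | inj₂ (_ , ¬yx₁)   | inj₁ refl         =
      ¬yx₁ (edge⁺ x₁x₂z∈F (∈triple⁺ (there (here refl))) (∈triple⁺ (here refl)) (x₁≢x₂ ∘ sym))
    ... | inj₂ (x₁∈S , _)   | inj₂ (x₂∈S , _)   = z∉W (S⊆W (subst (z ∈ₛ_)
      (linear-≡ x₁x₂z∈F S∈F x₁≢x₂ (∈triple⁺ (here refl)) (∈triple⁺ (there (here refl))) x₁∈S x₂∈S)
      (∈triple⁺ (there (there (here refl))))))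
    minimal : ∀ W′ → V′ ⊆ W′ → NEmpty F W′ → V′ ∪ ⁅ w ⁆ ⊆ W′
    minimal W′ V′⊆W′ W′-closed x∈ with x∈p∪q⁻ V′ ⁅ w ⁆ x∈
    ... | inj₁ x∈V′ = V′⊆W′ x∈V′
    ... | inj₂ x∈w with refl ← x∈⁅y⁆⇒x≡y w x∈w = decidable-stable (w ∈?ₛ W′) λ w∉W′ →
      W′-closed u v w (V′⊆W′ (∈triple⁺ (there (here refl)))) (V′⊆W′ (∈triple⁺ (there (there (here refl)))))
        u≢v w∉W′ (subst (_∈ F) (≡triple S∈F uvw-unique u∈S v∈S w∈S) S∈F)

  -- Otherwise {y, u, v} would have the four-element closure {y, u, v, w}.
  edge-to-third : ∀ {S u v w y} → S ∈ F → Unique (u ∷ v ∷ w ∷ []) → u ∈ₛ S → v ∈ₛ S → w ∈ₛ S →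
    y ≢ u → y ≢ v → ¬ Edge y u → ¬ Edge y v → Edge y w
  edge-to-third {u = u} {v} {w} {y} S∈F uvw-unique@((u≢v ∷ _) ∷ _) u∈S v∈S w∈S y≢u y≢v ¬yu ¬yv =
    decidable-stable (T? (shadowEdge F y w)) λ ¬yw →
      ¬small-closure (nontrivial-triple yuv-unique ¬yu)
        (closure-of-non-neighbour S∈F uvw-unique u∈S v∈S w∈S ¬yu ¬yv ¬yw)
        (∣p∣≤length {xs = y ∷ u ∷ v ∷ w ∷ []} λ x∈ → case x∈p∪q⁻ (triple F y u v) ⁅ w ⁆ x∈ of λ
          { (inj₁ x∈V′) → ∈-++⁺ˡ (∈triple⁻ x∈V′)
          ; (inj₂ x∈w)  → there (there (there (here (x∈⁅y⁆⇒x≡y w x∈w)))) })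
    where
    yuv-unique : Unique (y ∷ u ∷ v ∷ [])
    yuv-unique = (y≢u ∷ y≢v ∷ []) ∷ (u≢v ∷ []) ∷ [] ∷ []

  module C4 {S S′} (S∈F : S ∈ F) (w : C4Witness S S′) where

    open C4Witness w

    third : ∃[ e ] e ∈ₛ S × Unique (a ∷ b ∷ e ∷ []) × Edge c e × Edge d e
    third =
      let e , e∈S , e≢a , e≢b = third-vertex a b S∈F
          abe-unique = (a≢b ∷ (e≢a ∘ sym) ∷ []) ∷ ((e≢b ∘ sym) ∷ []) ∷ [] ∷ []
      in e , e∈S , abe-unique ,
         edge-to-third S∈F abe-unique a∈S b∈S e∈S (a≢c ∘ sym) (b≢c ∘ sym) (¬ac ∘ edge-sym) (¬bc ∘ edge-sym) ,
         edge-to-third S∈F abe-unique a∈S b∈S e∈S (a≢d ∘ sym) (b≢d ∘ sym) (¬ad ∘ edge-sym) (¬bd ∘ edge-sym)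

    uniqueNbr-c×d : UniqueNbr S c × UniqueNbr S d
    uniqueNbr-c×d =
      let e , e∈S , abe-unique , ce , de = third
      in uniqueNbr-of-triple S∈F abe-unique a∈S b∈S e∈S a≢c ¬ac ¬bc (edge-sym ce) ,
         uniqueNbr-of-triple S∈F abe-unique a∈S b∈S e∈S a≢d ¬ad ¬bd (edge-sym de)

    ab⊆S : ∀ {x} → x ∈ a ∷ b ∷ [] → x ∈ₛ S
    ab⊆S (here refl)         = a∈S
    ab⊆S (there (here refl)) = b∈S

    cd⊆S′ : ∀ {y} → y ∈ c ∷ d ∷ [] → y ∈ₛ S′
    cd⊆S′ (here refl)         = c∈S′
    cd⊆S′ (there (here refl)) = d∈S′

    cross : ∀ {x y} → x ∈ a ∷ b ∷ [] → y ∈ c ∷ d ∷ [] → x ≢ y × ¬ Edge x y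
    cross (here refl)         (here refl)         = a≢c , ¬ac
    cross (here refl)         (there (here refl)) = a≢d , ¬ad
    cross (there (here refl)) (here refl)         = b≢c , ¬bc
    cross (there (here refl)) (there (here refl)) = b≢d , ¬bd

    uniqueNbrs-disjoint : ∀ {v} → UniqueNbr S v → UniqueNbr S′ v → ⊥
    uniqueNbrs-disjoint {v} v∈X v∈X′ =
      let x , x∈ab , ¬xv = uniqueNbr-misses v∈X a≢b a∈S b∈S
          y , y∈cd , ¬yv = uniqueNbr-misses v∈X′ c≢d c∈S′ d∈S′
          x≢y , ¬xy = cross x∈ab y∈cd
          v≢x : v ≢ x
          v≢x v≡x = proj₁ (uniqueNbr⁻ v∈X) (subst (_∈ₛ S) (sym v≡x) (ab⊆S x∈ab))
          v≢y : v ≢ y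
          v≢y v≡y = proj₁ (uniqueNbr⁻ v∈X′) (subst (_∈ₛ S′) (sym v≡y) (cd⊆S′ y∈cd))
      in coTriangle-free ((v≢x ∷ v≢y ∷ []) ∷ (x≢y ∷ []) ∷ [] ∷ []) (¬xv ∘ edge-sym) ¬xy (¬yv ∘ edge-sym)

    Val+Val<n : Val F S + Val F S′ + 1 ≤ n
    Val+Val<n = let e , e∈S , _ , ce , de = third in Val+Val<n-via e∈S ce de
      where
      -- The third vertex e of S is counted by neither Val F S nor Val F S′.
      Val+Val<n-via : ∀ {e} → e ∈ₛ S → Edge c e → Edge d e → Val F S + Val F S′ + 1 ≤ n
      Val+Val<n-via {e} e∈S ce de = begin
        Val F S + Val F S′ + 1                           ≡⟨ +-assoc (Val F S) (Val F S′) 1 ⟩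
        Val F S + (Val F S′ + 1)                         ≡⟨ cong (Val F S +_) (sym (length-++ (uniqueNbrs S′))) ⟩
        Val F S + length (uniqueNbrs S′ ++ e ∷ [])       ≡⟨ sym (length-++ (uniqueNbrs S)) ⟩
        length (uniqueNbrs S ++ uniqueNbrs S′ ++ e ∷ []) ≤⟨ ⊆⇒length≤ all-unique (λ _ → ∈-allFin _) ⟩
        length (allFin n)                                ≡⟨ length-tabulate id ⟩
        n                                                ∎
        where
        open ≤-Reasoning
        e∉X′ : ∀ {v} → ¬ (v ∈ uniqueNbrs S′ × v ∈ e ∷ [])
        e∉X′ (v∈X′ , here refl) = two-nbrs⇒¬uniqueNbr c≢d c∈S′ d∈S′ ce de (∈-members⁻ v∈X′)
        X∩rest : ∀ {v} → ¬ (v ∈ uniqueNbrs S × v ∈ uniqueNbrs S′ ++ e ∷ [])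
        X∩rest (v∈X , v∈rest) with ∈-++⁻ (uniqueNbrs S′) v∈rest
        ... | inj₁ v∈X′        = uniqueNbrs-disjoint (∈-members⁻ v∈X) (∈-members⁻ v∈X′)
        ... | inj₂ (here refl) = proj₁ (uniqueNbr⁻ (∈-members⁻ v∈X)) e∈S
        all-unique : Unique (uniqueNbrs S ++ uniqueNbrs S′ ++ e ∷ [])
        all-unique = Unique.++⁺ (members-unique _) (Unique.++⁺ (members-unique _) ([] ∷ []) e∉X′) X∩rest

    pair-of-uniqueNbrs : S′ ∈ F → ∃[ q ] q ∈ pairs (uniqueNbrs S) × PairIn q S′
    pair-of-uniqueNbrs S′∈F =
      orient (∈-pairs⁺ (uniqueNbrs S) (∈-members⁺ (proj₁ uniqueNbr-c×d)) (∈-members⁺ (proj₂ uniqueNbr-c×d)) c≢d)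
      where
      orient : (c , d) ∈ pairs (uniqueNbrs S) ⊎ (d , c) ∈ pairs (uniqueNbrs S) →
        ∃[ q ] q ∈ pairs (uniqueNbrs S) × PairIn q S′
      orient (inj₁ cd) = _ , cd , S′∈F , c≢d , c∈S′ , d∈S′
      orient (inj₂ dc) = _ , dc , S′∈F , c≢d ∘ sym , d∈S′ , c∈S′

  deg≤Val-C2 : ∀ {S} → S ∈ F → deg F S ≤ Val F S C 2
  deg≤Val-C2 {S} S∈F = begin
    deg F S                        ≤⟨ length-≤-injection (flip PairIn) (Unique.filter⁺ (T? ∘ adjacentᵇ S) (proj₂ triples))
                                        pair-of (λ _ _ → PairIn-injective) ⟩
    length (pairs (uniqueNbrs S))  ≡⟨ length-pairs (uniqueNbrs S) ⟩
    Val F S C 2                    ∎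
    where
    open ≤-Reasoning
    pair-of : ∀ {S′} → S′ ∈ filterᵇ (adjacentᵇ S) F → ∃[ q ] q ∈ pairs (uniqueNbrs S) × PairIn q S′
    pair-of {S′} S′∈ = let S′∈F , adjacent = ∈-filterᵇ⁻ (adjacentᵇ S) F S′∈ in
      C4.pair-of-uniqueNbrs {S′ = S′} S∈F (adj⁻ S∈F (Equivalence.to T-≡ (proj₂ (T-∧⁻ (crossAB F S S′) adjacent)))) S′∈F

  deg-of-neighbour≤ : ∀ {S S′} → S ∈ F → S′ ∈ F → Adj F S S′ → deg F S′ ≤ (n ∸ Val F S ∸ 1) C 2
  deg-of-neighbour≤ {S} {S′} S∈F S′∈F adj = begin
    deg F S′                 ≤⟨ deg≤Val-C2 S′∈F ⟩
    Val F S′ C 2             ≤⟨ C2-mono {Val F S′} {n ∸ Val F S ∸ 1} (a+b<n⇒b≤n∸a∸1 (C4.Val+Val<n {S′ = S′} S∈F (adj⁻ S∈F adj))) ⟩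
    (n ∸ Val F S ∸ 1) C 2    ∎
    where open ≤-Reasoning

  module Classes {S} (S∈F : S ∈ F) where

    classᵇ : Fin n → Fin n → Bool
    classᵇ t v = uniqueNbrᵇ S v ∧ shadowEdge F t v

    Class : Fin n → Fin n → Set
    Class t v = T (classᵇ t v)

    class⁻ : ∀ {t v} → Class t v → UniqueNbr S v × Edge t v
    class⁻ {t} {v} = T-∧⁻ (uniqueNbrᵇ S v)

    class-∉ : ∀ {t v} → Class t v → v ∉ₛ S
    class-∉ = proj₁ ∘ uniqueNbr⁻ ∘ proj₁ ∘ class⁻

    class-misses : ∀ {t s v} → t ≢ s → t ∈ₛ S → s ∈ₛ S → Class t v → ¬ Edge s v
    class-misses t≢s t∈S s∈S tv sv = two-nbrs⇒¬uniqueNbr t≢s t∈S s∈S (proj₂ (class⁻ tv)) sv (proj₁ (class⁻ tv))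

    class-disjoint : ∀ {t t′ v} → t ≢ t′ → t ∈ₛ S → t′ ∈ₛ S → Class t v → ¬ Class t′ v
    class-disjoint t≢t′ t∈S t′∈S tv t′v = class-misses t≢t′ t∈S t′∈S tv (proj₂ (class⁻ t′v))

    ≢-outside : ∀ {t s v} → s ∈ₛ S → Class t v → s ≢ v
    ≢-outside s∈S tv refl = class-∉ tv s∈S

    -- With another vertex s of S, two non-adjacent vertices of a class would form a non-edge triangle.
    class-clique : ∀ {t u v} → t ∈ₛ S → Class t u → Class t v → u ≢ v → Edge u v
    class-clique {t} {u} {v} t∈S tu tv u≢v with s , _ , ((t≢s ∷ _) ∷ _) , s∈S , _ ← other-vertices S∈F t∈S =
      decidable-stable (T? (shadowEdge F u v)) λ ¬uv →
        coTriangle-free ((u≢v ∷ (≢-outside s∈S tu ∘ sym) ∷ []) ∷ ((≢-outside s∈S tv ∘ sym) ∷ []) ∷ [] ∷ [])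
          ¬uv (class-misses t≢s t∈S s∈S tv ∘ edge-sym) (class-misses t≢s t∈S s∈S tu ∘ edge-sym)

    -- Another vertex s of S misses u and v, so it is adjacent to the third vertex of S′ (edge-to-third).
    no-three-in-class : ∀ {t S′ u v w} → t ∈ₛ S → S′ ∈ F → Unique (u ∷ v ∷ w ∷ []) →
      u ∈ₛ S′ → v ∈ₛ S′ → w ∈ₛ S′ → Class t u → Class t v → ¬ Class t w
    no-three-in-class t∈S S′∈F uvw-unique u∈S′ v∈S′ w∈S′ tu tv tw
      with s , _ , ((t≢s ∷ _) ∷ _) , s∈S , _ ← other-vertices S∈F t∈S =
      class-misses t≢s t∈S s∈S tw (edge-to-third S′∈F uvw-unique u∈S′ v∈S′ w∈S′
        (≢-outside s∈S tu) (≢-outside s∈S tv) (class-misses t≢s t∈S s∈S tu) (class-misses t≢s t∈S s∈S tv))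

    class-pair-witness : ∀ {t S′ u v} → t ∈ₛ S → u ≢ v → u ∈ₛ S′ → v ∈ₛ S′ → Class t u → Class t v → C4Witness S S′
    class-pair-witness {t} {u = u} {v} t∈S u≢v u∈S′ v∈S′ tu tv
      with s₁ , s₂ , ((t≢s₁ ∷ t≢s₂ ∷ []) ∷ (s₁≢s₂ ∷ []) ∷ _) , s₁∈S , s₂∈S ← other-vertices S∈F t∈S = record
      { a = s₁ ; b = s₂ ; c = u ; d = v
      ; a∈S = s₁∈S ; b∈S = s₂∈S ; c∈S′ = u∈S′ ; d∈S′ = v∈S′
      ; a≢b = s₁≢s₂ ; a≢c = ≢-outside s₁∈S tu ; a≢d = ≢-outside s₁∈S tv
      ; b≢c = ≢-outside s₂∈S tu ; b≢d = ≢-outside s₂∈S tv ; c≢d = u≢v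
      ; ¬ac = class-misses t≢s₁ t∈S s₁∈S tu ; ¬ad = class-misses t≢s₁ t∈S s₁∈S tv
      ; ¬bc = class-misses t≢s₂ t∈S s₂∈S tu ; ¬bd = class-misses t≢s₂ t∈S s₂∈S tv }

    classIn : Fin n → Subset n → List (Fin n)
    classIn t S′ = members (λ v → lookup S′ v ∧ classᵇ t v)

    spansᵇ : Fin n → Subset n → Bool
    spansᵇ t S′ = 2 ≤ᵇ length (classIn t S′)

    spans⁺ : ∀ {t S′ u v} → u ≢ v → u ∈ₛ S′ → v ∈ₛ S′ → Class t u → Class t v → T (spansᵇ t S′)
    spans⁺ {t} {S′} u≢v u∈S′ v∈S′ tu tv = ≤⇒≤ᵇ (⊆⇒length≤ {ys = classIn t S′} ((u≢v ∷ []) ∷ [] ∷ []) λ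
      { (here refl) → ∈-members⁺ (T-∧⁺ (∈ₛ⇒T u∈S′) tu) ; (there (here refl)) → ∈-members⁺ (T-∧⁺ (∈ₛ⇒T v∈S′) tv) })

    spans⁻ : ∀ {t S′} → T (spansᵇ t S′) →
      ∃[ u ] ∃[ v ] u ≢ v × u ∈ₛ S′ × v ∈ₛ S′ × Class t u × Class t v
    spans⁻ {t} {S′} two≤
      with u , u∈ , _    ← ∃-∉ _≟_ {xs = []} (members-unique _) (≤-trans (s≤s z≤n) (≤ᵇ⇒≤ 2 _ two≤))
      with v , v∈ , v∉u ← ∃-∉ _≟_ {xs = u ∷ []} (members-unique _) (≤ᵇ⇒≤ 2 _ two≤)
      with u∈S′ , tu ← T-∧⁻ (lookup S′ u) (∈-members⁻ u∈)
      with v∈S′ , tv ← T-∧⁻ (lookup S′ v) (∈-members⁻ v∈) =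
      u , v , (v∉u ∘ here ∘ sym) , T⇒∈ₛ u∈S′ , T⇒∈ₛ v∈S′ , tu , tv

    spans-disjoint : ∀ {t t′ S′} → t ≢ t′ → t ∈ₛ S → t′ ∈ₛ S → S′ ∈ F → T (spansᵇ t S′) → ¬ T (spansᵇ t′ S′)
    spans-disjoint {t} {t′} {S′} t≢t′ t∈S t′∈S S′∈F spans spans′ =
      let u , v , u≢v , u∈S′ , v∈S′ , tu , tv = spans⁻ {t} {S′} spans
          u′ , v′ , u′≢v′ , u′∈S′ , v′∈S′ , t′u′ , t′v′ = spans⁻ {t′} {S′} spans′
          apart : ∀ {x y} → Class t x → Class t′ y → x ≢ y
          apart tx t′y x≡y = class-disjoint t≢t′ t∈S t′∈S tx (subst (Class t′) (sym x≡y) t′y)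
      in ≤⇒≯ (≤-reflexive (∣S∣≡3 S′∈F)) (length≤∣p∣ {p = S′}
        ((u≢v ∷ apart tu t′u′ ∷ apart tu t′v′ ∷ []) ∷ (apart tv t′u′ ∷ apart tv t′v′ ∷ []) ∷ (u′≢v′ ∷ []) ∷ [] ∷ []) λ
        { (here refl) → u∈S′ ; (there (here refl)) → v∈S′
        ; (there (there (here refl))) → u′∈S′ ; (there (there (there (here refl)))) → v′∈S′ })

    class-pairs≤spans : ∀ {t} → t ∈ₛ S → length (members (classᵇ t)) C 2 ≤ length (filterᵇ (spansᵇ t) F)
    class-pairs≤spans {t} t∈S = begin
      length (members (classᵇ t)) C 2         ≡⟨ sym (length-pairs (members (classᵇ t))) ⟩
      length (pairs (members (classᵇ t)))     ≤⟨ length-≤-injection PairIn (pairs-unique (members-unique _)) triple-of injective ⟩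
      length (filterᵇ (spansᵇ t) F)           ∎
      where
      open ≤-Reasoning
      triple-of : ∀ {q} → q ∈ pairs (members (classᵇ t)) → ∃[ S′ ] S′ ∈ filterᵇ (spansᵇ t) F × PairIn q S′
      triple-of {u , v} uv∈ =
        let u∈ , v∈ = ∈-pairs⁻ _ uv∈
            u≢v = pairs-≢ (members-unique _) uv∈
            _ , S′ , S′∈F , u∈S′ , v∈S′ = edge⁻ (class-clique t∈S (∈-members⁻ u∈) (∈-members⁻ v∈) u≢v)
        in S′ , ∈-filter⁺ (T? ∘ spansᵇ t) S′∈F (spans⁺ u≢v u∈S′ v∈S′ (∈-members⁻ u∈) (∈-members⁻ v∈)) , S′∈F , u≢v , u∈S′ , v∈S′
      injective : ∀ {q q′ S′} → q ∈ pairs (members (classᵇ t)) → q′ ∈ pairs (members (classᵇ t)) →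
        PairIn q S′ → PairIn q′ S′ → q ≡ q′
      injective {u , v} {u′ , v′} {S′} uv∈ u′v′∈ (S′∈F , u≢v , u∈S′ , v∈S′) (_ , _ , u′∈S′ , v′∈S′) =
        pairs-≡ (members-unique _) uv∈ u′v′∈ (in-uv u′∈S′ (proj₁ (in-class u′v′∈))) (in-uv v′∈S′ (proj₂ (in-class u′v′∈)))
        where
        in-class : ∀ {x y} → (x , y) ∈ pairs (members (classᵇ t)) → Class t x × Class t y
        in-class xy∈ = let x∈ , y∈ = ∈-pairs⁻ _ xy∈ in ∈-members⁻ x∈ , ∈-members⁻ y∈
        in-uv : ∀ {x} → x ∈ₛ S′ → Class t x → x ∈ u ∷ v ∷ []
        in-uv {x} x∈S′ tx = decidable-stable (x ∈? u ∷ v ∷ []) λ x∉uv →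
          no-three-in-class t∈S S′∈F
            ((u≢v ∷ (x∉uv ∘ here ∘ sym) ∷ []) ∷ ((x∉uv ∘ there ∘ here ∘ sym) ∷ []) ∷ [] ∷ [])
            u∈S′ v∈S′ x∈S′ (proj₁ (in-class uv∈)) (proj₂ (in-class uv∈)) tx

  module TripleInA {S} (S∈F : S ∈ F) (S∈A : InA F S) where

    open Classes S∈F

    spans⇒adjacent : ∀ {t S′} → t ∈ₛ S → S′ ∈ F → T (spansᵇ t S′) → T (adjacentᵇ S S′)
    spans⇒adjacent {t} {S′} t∈S S′∈F spans =
      let u , v , u≢v , u∈S′ , v∈S′ , tu , tv = spans⁻ {t} {S′} spans
          w = class-pair-witness t∈S u≢v u∈S′ v∈S′ tu tv
          S′∉A : ¬ InA F S′
          S′∉A = halves-overlap {a = Val F S} {b = Val F S′} (C4.Val+Val<n S∈F w) S∈A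
      in T-∧⁺ (Equivalence.from (T-∨ {inAᵇ F S ∧ not (inAᵇ F S′)}) (inj₁ (T-∧⁺ (≤⇒≤ᵇ S∈A) (T-not⁺ (S′∉A ∘ ≤ᵇ⇒≤ n _)))))
              (Equivalence.from T-≡ (adj⁺ w))

    Val≡Σclass : ∀ {x y z} → Unique (x ∷ y ∷ z ∷ []) → x ∈ₛ S → y ∈ₛ S → z ∈ₛ S →
      Val F S ≡ length (members (classᵇ x)) + length (members (classᵇ y)) + length (members (classᵇ z))
    Val≡Σclass {x} {y} {z} xyz-unique@((x≢y ∷ x≢z ∷ []) ∷ (y≢z ∷ []) ∷ _) x∈S y∈S z∈S = ≤-antisym Val≤Σ Σ≤Val
      where
      classᵇxy : Fin n → Bool
      classᵇxy v = classᵇ x v ∨ classᵇ y v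
      cover : ∀ {v} → UniqueNbr S v → T (classᵇxy v) ⊎ Class z v
      cover {v} unique = let u , u∈S , uv = proj₂ (uniqueNbr⁻ unique) in
        case vertices S∈F xyz-unique x∈S y∈S z∈S u∈S of λ
          { (here refl) → inj₁ (Equivalence.from (T-∨ {classᵇ x v}) (inj₁ (T-∧⁺ unique uv)))
          ; (there (here refl)) → inj₁ (Equivalence.from (T-∨ {classᵇ x v}) (inj₂ (T-∧⁺ unique uv)))
          ; (there (there (here refl))) → inj₂ (T-∧⁺ unique uv) }
      Val≤Σ : Val F S ≤ length (members (classᵇ x)) + length (members (classᵇ y)) + length (members (classᵇ z))
      Val≤Σ = ≤-trans (length-filter-≤-+ classᵇxy (classᵇ z) (uniqueNbrᵇ S) (allFin⁺ n) λ _ → cover)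
        (+-monoˡ-≤ _ (length-filter-≤-+ (classᵇ x) (classᵇ y) classᵇxy (allFin⁺ n) λ _ → T-∨⁻ (classᵇ x _)))
      Σ≤Val : length (members (classᵇ x)) + length (members (classᵇ y)) + length (members (classᵇ z)) ≤ Val F S
      Σ≤Val = ≤-trans
        (+-monoˡ-≤ _ (length-filter-+ (classᵇ x) (classᵇ y) classᵇxy (allFin⁺ n)
          (λ _ → class-disjoint x≢y x∈S y∈S) λ _ → Equivalence.from T-∨))
        (length-filter-+ classᵇxy (classᵇ z) (uniqueNbrᵇ S) (allFin⁺ n)
          (λ _ xy z → [ class-disjoint x≢z x∈S z∈S , class-disjoint y≢z y∈S z∈S ]′ (T-∨⁻ (classᵇ x _) xy) z)
          λ _ → [ [ proj₁ ∘ class⁻ , proj₁ ∘ class⁻ ]′ ∘ T-∨⁻ (classᵇ x _) , proj₁ ∘ class⁻ ]′)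

    Σspans≤deg : ∀ {x y z} → Unique (x ∷ y ∷ z ∷ []) → x ∈ₛ S → y ∈ₛ S → z ∈ₛ S →
      length (filterᵇ (spansᵇ x) F) + length (filterᵇ (spansᵇ y) F) + length (filterᵇ (spansᵇ z) F) ≤ deg F S
    Σspans≤deg {x} {y} {z} ((x≢y ∷ x≢z ∷ []) ∷ (y≢z ∷ []) ∷ _) x∈S y∈S z∈S =
      ≤-trans (+-monoˡ-≤ _ (length-filter-+ (spansᵇ x) (spansᵇ y) spansᵇxy (proj₂ triples)
                  (λ S′∈F → spans-disjoint x≢y x∈S y∈S S′∈F) λ _ → Equivalence.from T-∨))
              (length-filter-+ spansᵇxy (spansᵇ z) (adjacentᵇ S) (proj₂ triples)
                  (λ {S′} S′∈F xy z → [ spans-disjoint x≢z x∈S z∈S S′∈F , spans-disjoint y≢z y∈S z∈S S′∈F ]′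
                                   (T-∨⁻ (spansᵇ x S′) xy) z)
                  λ {S′} S′∈F → [ [ spans⇒adjacent x∈S S′∈F , spans⇒adjacent y∈S S′∈F ]′ ∘ T-∨⁻ (spansᵇ x S′)
                           , spans⇒adjacent z∈S S′∈F ]′)
      where
      spansᵇxy : Subset n → Bool
      spansᵇxy S′ = spansᵇ x S′ ∨ spansᵇ y S′

    Val²≤6deg+3Val : Val F S * Val F S ≤ 6 * deg F S + 3 * Val F S
    Val²≤6deg+3Val =
      let x , x∈S = some-vertex S∈F
          y , z , xyz-unique , y∈S , z∈S = other-vertices S∈F x∈S
      in subst (λ V → V * V ≤ 6 * deg F S + 3 * V) (sym (Val≡Σclass xyz-unique x∈S y∈S z∈S))
           (sum-square-bound (length (members (classᵇ x))) (length (members (classᵇ y))) (length (members (classᵇ z)))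
              (deg F S) (≤-trans
              (+-mono-≤ (+-mono-≤ (class-pairs≤spans x∈S) (class-pairs≤spans y∈S)) (class-pairs≤spans z∈S))
              (Σspans≤deg xyz-unique x∈S y∈S z∈S)))

proposition3 : (n : ℕ) → 5 < n → (F : List (Subset n)) →
    IsTripleSystem F → IsLinear F → IsSpreading F →
    (∀ T → T ∈ F → InA F T →
        Val F T * Val F T ≤ 6 * deg F T + 3 * Val F T)
    × (∀ T T' → T ∈ F → T' ∈ F → InA F T → InB F T' → Adj F T T' →
        deg F T' ≤ (n ∸ Val F T ∸ 1) C 2)
proposition3 n 5<n F triples linear spreading =
  (λ _ T∈F T∈A → TripleInA.Val²≤6deg+3Val T∈F T∈A) ,
  (λ _ _ T∈F T′∈F _ _ adj → deg-of-neighbour≤ T∈F T′∈F adj)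
  where
  open Spreading triples linear spreading (<-trans (n<1+n 4) 5<n)
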